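{- Let $k\geq 3$ be an integer and $r\geq 3k-6$. The star $K_{1,r}$ is uniquely reconstructible in the class of triangle-free graphs, i.e. it is the only triangle-free graph on its vertex set $V$ whose set of connected $k$-subsets equals that of $K_{1,r}$ and whose set of disconnected $k$-subsets equals that of $K_{1,r}$.
   Context: A $k$-subset $S$ of $V$ is connected (resp. disconnected) in a graph $G$ on $V$ if $G[S]$ is connected (resp. disconnected). -}

module Defs where

open import Data.Nat using (ℕ)
open import Data.Fin using (Fin)
open import Data.Fin.Subset using (Subset; _∈_)
open import Data.Product using (_×_; _,_)
open import Data.Sum using (_⊎_; inj₁; inj₂)
open import Relation.Nullary using (¬_)
open import Relation.Binary.PropositionalEquality using (_≡_; _≢_)

record Graph (n : ℕ) : Set₁ where
  field
    Adj    : Fin n → Fin n → Set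
    sym    : ∀ {x y} → Adj x y → Adj y x
    irrefl : ∀ {x} → ¬ Adj x x
open Graph public

-- The star on vertex set Fin n with centre c: x ~ y iff exactly one of x, y is c.
-- On Fin (suc r) this is K_{1,r}.
StarAdj : ∀ {n} → Fin n → Fin n → Fin n → Set
StarAdj c x y = (x ≡ c × y ≢ c) ⊎ (y ≡ c × x ≢ c)

star : ∀ {n} → Fin n → Graph n
star c = record
  { Adj = StarAdj c
  ; sym = λ { (inj₁ p) → inj₂ p ; (inj₂ p) → inj₁ p }
  ; irrefl = λ { (inj₁ (p , q)) → q p ; (inj₂ (p , q)) → q p }
  }

TriangleFree : ∀ {n} → Graph n → Set
TriangleFree G = ∀ a b c → ¬ (Adj G a b × Adj G b c × Adj G a c)

data Reach {n} (G : Graph n) (S : Subset n) : Fin n → Fin n → Set where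
  here : ∀ {x} → x ∈ S → Reach G S x x
  step : ∀ {x z y} → x ∈ S → Adj G x z → Reach G S z y → Reach G S x y

Connected : ∀ {n} → Graph n → Subset n → Set
Connected G S = ∀ x y → x ∈ S → y ∈ S → Reach G S x y

Disconnected : ∀ {n} → Graph n → Subset n → Set
Disconnected G S = ¬ Connected G S

-- Every vertex x ≠ c of G must be adjacent to c. If x had at least k - 1 neighbours, x together
-- with k - 1 of them would be a k-set connected in G (dominated by x) but, if x ≁ c, missing c and
-- hence disconnected in the star. If x has at most k - 2 neighbours, at least k - 2 vertices lie
-- outside N(x) ∪ {x, c} as soon as r ≥ 2k - 3; with x and c they form a k-set connected in the
-- star, so x has a neighbour inside it, which can only be c. (Adjacency is not decidable, so this
-- only shows x ≁ c is absurd.) Triangle-freeness then forbids edges between two leaves, and the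
-- second argument with N(x) replaced by the empty set yields x ~ c outright.
module Submission where

open import Defs hiding (sym)
open import Data.Nat using (ℕ; zero; suc; _≤_; _<_; _+_; _*_; _∸_; z≤n; s≤s)
open import Data.Nat.Properties
  using (module ≤-Reasoning; ≤-trans; ≤-reflexive; n≤1+n; +-suc; +-monoʳ-≤; +-mono-≤; ∸-monoʳ-≤;
         m+n≤o⇒m≤o∸n; m+n∸m≡n; ≮⇒≥; ≤-refl; *-monoˡ-<)
open import Data.Nat.Tactic.RingSolver using (solve-∀)
open import Data.Fin using (Fin; zero; suc; _≟_)
open import Data.Fin.Subset
  using (Subset; ∣_∣; _∈_; _∉_; _⊆_; _∪_; ∁; ⁅_⁆; ⊥; Nonempty; inside; outside)
open import Data.Fin.Subset.Properties
  using (∪-identityˡ; x∈p∪q⁻; x∈p∪q⁺; x∈⁅x⁆; x∈⁅y⁆⇒x≡y; x∈∁p⇒x∉p;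
         ∣∁p∣≡n∸∣p∣; ∣⁅x⁆∣≡1; ⊥⊆; ∣⊥∣≡0; out⊆; in⊆in)
open import Data.Vec using (_∷_; []; here; there)
open import Data.Product using (_×_; _,_; proj₁; proj₂; ∃-syntax)
open import Data.Sum using (_⊎_; inj₁; inj₂)
open import Function using (_∘_; case_of_)
open import Function.Bundles using (_⇔_; mk⇔; Equivalence)
open import Relation.Nullary using (¬_; yes; no; does; contradiction)
open import Relation.Nullary.Decidable using (¬¬-excluded-middle)
open import Relation.Unary using (Pred; Decidable)
open import Relation.Binary.PropositionalEquality using (_≡_; _≢_; refl; sym; trans; cong; subst)
open import Level using (Level)

private
  variable
    ℓ : Level
    n : ℕ

∣p∪q∣≤∣p∣+∣q∣ : ∀ (p q : Subset n) → ∣ p ∪ q ∣ ≤ ∣ p ∣ + ∣ q ∣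
∣p∪q∣≤∣p∣+∣q∣ []            []            = z≤n
∣p∪q∣≤∣p∣+∣q∣ (outside ∷ p) (outside ∷ q) = ∣p∪q∣≤∣p∣+∣q∣ p q
∣p∪q∣≤∣p∣+∣q∣ (outside ∷ p) (inside ∷ q)  =
  ≤-trans (s≤s (∣p∪q∣≤∣p∣+∣q∣ p q)) (≤-reflexive (sym (+-suc ∣ p ∣ ∣ q ∣)))
∣p∪q∣≤∣p∣+∣q∣ (inside ∷ p)  (outside ∷ q) = s≤s (∣p∪q∣≤∣p∣+∣q∣ p q)
∣p∪q∣≤∣p∣+∣q∣ (inside ∷ p)  (inside ∷ q)  =
  s≤s (≤-trans (∣p∪q∣≤∣p∣+∣q∣ p q) (+-monoʳ-≤ ∣ p ∣ (n≤1+n ∣ q ∣)))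

x∉p⇒∣⁅x⁆∪p∣≡1+∣p∣ : ∀ {x : Fin n} {p} → x ∉ p → ∣ ⁅ x ⁆ ∪ p ∣ ≡ suc ∣ p ∣
x∉p⇒∣⁅x⁆∪p∣≡1+∣p∣ {x = zero}  {outside ∷ p} _   = cong (suc ∘ ∣_∣) (∪-identityˡ p)
x∉p⇒∣⁅x⁆∪p∣≡1+∣p∣ {x = zero}  {inside ∷ p}  x∉p = contradiction here x∉p
x∉p⇒∣⁅x⁆∪p∣≡1+∣p∣ {x = suc x} {outside ∷ p} x∉p = x∉p⇒∣⁅x⁆∪p∣≡1+∣p∣ (x∉p ∘ there)
x∉p⇒∣⁅x⁆∪p∣≡1+∣p∣ {x = suc x} {inside ∷ p}  x∉p = cong suc (x∉p⇒∣⁅x⁆∪p∣≡1+∣p∣ (x∉p ∘ there))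

⊆-ofSize : ∀ (p : Subset n) {j} → j ≤ ∣ p ∣ → ∃[ q ] q ⊆ p × ∣ q ∣ ≡ j
⊆-ofSize [] z≤n = [] , (λ ()) , refl
⊆-ofSize (outside ∷ p) j≤∣p∣ with ⊆-ofSize p j≤∣p∣
... | q , q⊆p , ∣q∣≡j = outside ∷ q , out⊆ q⊆p , ∣q∣≡j
⊆-ofSize {suc n} (inside ∷ p) z≤n = ⊥ , ⊥⊆ , ∣⊥∣≡0 (suc n)
⊆-ofSize (inside ∷ p) (s≤s j≤∣p∣) with ⊆-ofSize p j≤∣p∣
... | q , q⊆p , ∣q∣≡j = inside ∷ q , in⊆in q⊆p , cong suc ∣q∣≡j

∣p∣>0⇒nonempty : ∀ (p : Subset n) → 0 < ∣ p ∣ → Nonempty p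
∣p∣>0⇒nonempty (inside ∷ p)  _       = zero , here
∣p∣>0⇒nonempty (outside ∷ p) 0<∣p∣ with ∣p∣>0⇒nonempty p 0<∣p∣
... | x , x∈p = suc x , there x∈p

subsetOf : {P : Pred (Fin n) ℓ} → Decidable P → Subset n
subsetOf {zero}  P? = []
subsetOf {suc n} P? = does (P? zero) ∷ subsetOf (P? ∘ suc)

∈-subsetOf⁺ : {P : Pred (Fin n) ℓ} (P? : Decidable P) {x : Fin n} → P x → x ∈ subsetOf P?
∈-subsetOf⁺ P? {zero} Px with P? zero
... | yes _  = here
... | no ¬Px = contradiction Px ¬Px
∈-subsetOf⁺ P? {suc x} Px = there (∈-subsetOf⁺ (P? ∘ suc) Px)

∈-subsetOf⁻ : {P : Pred (Fin n) ℓ} (P? : Decidable P) {x : Fin n} → x ∈ subsetOf P? → P x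
∈-subsetOf⁻ P? {zero} x∈ with P? zero
∈-subsetOf⁻ P? {zero} x∈ | yes Px = Px
∈-subsetOf⁻ P? {zero} () | no _
∈-subsetOf⁻ P? {suc x} (there x∈) = ∈-subsetOf⁻ (P? ∘ suc) x∈

¬¬-decidable : (P : Pred (Fin n) ℓ) → ¬ ¬ Decidable P
¬¬-decidable {zero}  P k = k (λ ())
¬¬-decidable {suc n} P k =
  ¬¬-excluded-middle λ P0? → ¬¬-decidable (P ∘ suc) λ P∘suc? →
    k λ { zero → P0? ; (suc x) → P∘suc? x }

pair∪⊆-ofSize : ∀ {x y : Fin n} (A : Subset n) {m} → x ≢ y → x ∉ A → y ∉ A → m ≤ ∣ A ∣ →
  ∃[ S ] ∣ S ∣ ≡ 2 + m × x ∈ S × y ∈ S × (∀ {z} → z ∈ S → z ≡ x ⊎ z ≡ y ⊎ z ∈ A)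
pair∪⊆-ofSize {x = x} {y} A {m} x≢y x∉A y∉A m≤∣A∣ with ⊆-ofSize A m≤∣A∣
... | q , q⊆A , ∣q∣≡m = ⁅ x ⁆ ∪ (⁅ y ⁆ ∪ q) , ∣S∣≡2+m , x∈S , y∈S , classify
  where
  x∉⁅y⁆∪q : x ∉ ⁅ y ⁆ ∪ q
  x∉⁅y⁆∪q x∈ with x∈p∪q⁻ ⁅ y ⁆ q x∈
  ... | inj₁ x∈⁅y⁆ = x≢y (x∈⁅y⁆⇒x≡y y x∈⁅y⁆)
  ... | inj₂ x∈q   = x∉A (q⊆A x∈q)

  ∣S∣≡2+m : ∣ ⁅ x ⁆ ∪ (⁅ y ⁆ ∪ q) ∣ ≡ 2 + m
  ∣S∣≡2+m = trans (x∉p⇒∣⁅x⁆∪p∣≡1+∣p∣ x∉⁅y⁆∪q)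
           (cong suc (trans (x∉p⇒∣⁅x⁆∪p∣≡1+∣p∣ (y∉A ∘ q⊆A)) (cong suc ∣q∣≡m)))

  x∈S : x ∈ ⁅ x ⁆ ∪ (⁅ y ⁆ ∪ q)
  x∈S = x∈p∪q⁺ (inj₁ (x∈⁅x⁆ x))

  y∈S : y ∈ ⁅ x ⁆ ∪ (⁅ y ⁆ ∪ q)
  y∈S = x∈p∪q⁺ (inj₂ (x∈p∪q⁺ (inj₁ (x∈⁅x⁆ y))))

  classify : ∀ {z} → z ∈ ⁅ x ⁆ ∪ (⁅ y ⁆ ∪ q) → z ≡ x ⊎ z ≡ y ⊎ z ∈ A
  classify z∈ with x∈p∪q⁻ ⁅ x ⁆ _ z∈
  ... | inj₁ z∈⁅x⁆ = inj₁ (x∈⁅y⁆⇒x≡y x z∈⁅x⁆)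
  ... | inj₂ z∈⁅y⁆∪q with x∈p∪q⁻ ⁅ y ⁆ q z∈⁅y⁆∪q
  ...   | inj₁ z∈⁅y⁆ = inj₂ (inj₁ (x∈⁅y⁆⇒x≡y y z∈⁅y⁆))
  ...   | inj₂ z∈q   = inj₂ (inj₂ (q⊆A z∈q))

module _ {G : Graph n} {S : Subset n} where

  Reach-source∈ : ∀ {x y} → Reach G S x y → x ∈ S
  Reach-source∈ (here x∈S)     = x∈S
  Reach-source∈ (step x∈S _ _) = x∈S

  Reach⇒neighbour : ∀ {x y} → Reach G S x y → x ≢ y → ∃[ z ] z ∈ S × Adj G x z
  Reach⇒neighbour (here _)           x≢x = contradiction refl x≢x
  Reach⇒neighbour (step _ x~z z⇝y) _   = _ , Reach-source∈ z⇝y , x~z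

  Dominates : Fin n → Set
  Dominates x = ∀ {y} → y ∈ S → y ≡ x ⊎ Adj G x y

  dominator⇝ : ∀ {x y} → x ∈ S → Dominates x → y ∈ S → Reach G S x y
  dominator⇝ x∈S dom y∈S with dom y∈S
  ... | inj₁ refl = here x∈S
  ... | inj₂ x~y  = step x∈S x~y (here y∈S)

  dominated⇒connected : ∀ {x} → x ∈ S → Dominates x → Connected G S
  dominated⇒connected x∈S dom u v u∈S v∈S with dom u∈S
  ... | inj₁ refl = dominator⇝ x∈S dom v∈S
  ... | inj₂ x~u  = step u∈S (Graph.sym G x~u) (dominator⇝ x∈S dom v∈S)

module _ {c : Fin n} {S : Subset n} where

  star-connected : c ∈ S → Connected (star c) S
  star-connected c∈S = dominated⇒connected c∈S c-dominates
    where
    c-dominates : ∀ {y} → y ∈ S → y ≡ c ⊎ StarAdj c c y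
    c-dominates {y} _ with y ≟ c
    ... | yes y≡c = inj₁ y≡c
    ... | no y≢c  = inj₂ (inj₁ (refl , y≢c))

  star-Reach-without-centre : ∀ {x y} → c ∉ S → Reach (star c) S x y → x ≡ y
  star-Reach-without-centre c∉S (here _)                      = refl
  star-Reach-without-centre c∉S (step x∈S (inj₁ (x≡c , _)) _) = contradiction (subst (_∈ S) x≡c x∈S) c∉S
  star-Reach-without-centre c∉S (step _ (inj₂ (z≡c , _)) z⇝y) =
    contradiction (subst (_∈ S) z≡c (Reach-source∈ z⇝y)) c∉S

  star-disconnected : ∀ {x y} → c ∉ S → x ∈ S → y ∈ S → x ≢ y → ¬ Connected (star c) S
  star-disconnected c∉S x∈S y∈S x≢y conn = x≢y (star-Reach-without-centre c∉S (conn _ _ x∈S y∈S))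

-- Here m = k - 2, and 2 * m < r says r ≥ 2k - 3, which follows from r ≥ 3k - 6 when k ≥ 3.
module StarReconstruction
  {r : ℕ} (m : ℕ) (2m<r : 2 * m < r) (c : Fin (suc r)) (G : Graph (suc r))
  (same-connected : ∀ S → ∣ S ∣ ≡ 2 + m → Connected G S ⇔ Connected (star c) S)
  where

  Outside : Fin (suc r) → Subset (suc r) → Subset (suc r)
  Outside x N = ∁ (⁅ x ⁆ ∪ (⁅ c ⁆ ∪ N))

  ∈Outside⇒ : ∀ {x z N} → z ∈ Outside x N → z ≢ x × z ≢ c × z ∉ N
  ∈Outside⇒ {x} {z} {N} z∈ =
      (λ { refl → z∉ (x∈p∪q⁺ (inj₁ (x∈⁅x⁆ x))) })
    , (λ { refl → z∉ (x∈p∪q⁺ (inj₂ (x∈p∪q⁺ (inj₁ (x∈⁅x⁆ c))))) })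
    , (λ z∈N → z∉ (x∈p∪q⁺ (inj₂ (x∈p∪q⁺ (inj₂ z∈N)))))
    where
    z∉ : z ∉ ⁅ x ⁆ ∪ (⁅ c ⁆ ∪ N)
    z∉ = x∈∁p⇒x∉p z∈

  room-Outside : ∀ x N → ∣ N ∣ ≤ m → m ≤ ∣ Outside x N ∣
  room-Outside x N ∣N∣≤m = begin
    m                                   ≤⟨ m+n≤o⇒m≤o∸n m (≤-trans (≤-reflexive (m+2+m≡2+2m m)) (s≤s 2m<r)) ⟩
    suc r ∸ (2 + m)                     ≤⟨ ∸-monoʳ-≤ (suc r) ∣removed∣≤2+m ⟩
    suc r ∸ ∣ ⁅ x ⁆ ∪ (⁅ c ⁆ ∪ N) ∣      ≡⟨ sym (∣∁p∣≡n∸∣p∣ (⁅ x ⁆ ∪ (⁅ c ⁆ ∪ N))) ⟩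
    ∣ Outside x N ∣                     ∎
    where
    open ≤-Reasoning
    m+2+m≡2+2m : ∀ m → m + (2 + m) ≡ 2 + 2 * m
    m+2+m≡2+2m = solve-∀
    ∣removed∣≤2+m : ∣ ⁅ x ⁆ ∪ (⁅ c ⁆ ∪ N) ∣ ≤ 2 + m
    ∣removed∣≤2+m =
      ≤-trans (∣p∪q∣≤∣p∣+∣q∣ ⁅ x ⁆ _) (+-mono-≤ (≤-reflexive (∣⁅x⁆∣≡1 x))
        (≤-trans (∣p∪q∣≤∣p∣+∣q∣ ⁅ c ⁆ N) (+-mono-≤ (≤-reflexive (∣⁅x⁆∣≡1 c)) ∣N∣≤m)))

  neighbour-at-centre-or-outside : ∀ {x} → x ≢ c → (N : Subset (suc r)) → ∣ N ∣ ≤ m →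
    ∃[ z ] Adj G x z × (z ≡ c ⊎ z ≢ c × z ∉ N)
  neighbour-at-centre-or-outside {x} x≢c N ∣N∣≤m
    with pair∪⊆-ofSize (Outside x N) x≢c (λ x∈ → proj₁ (∈Outside⇒ x∈) refl)
           (λ c∈ → proj₁ (proj₂ (∈Outside⇒ c∈)) refl) (room-Outside x N ∣N∣≤m)
  ... | S , ∣S∣≡2+m , x∈S , c∈S , classify
    with Reach⇒neighbour
           (Equivalence.from (same-connected S ∣S∣≡2+m) (star-connected c∈S) x c x∈S c∈S) x≢c
  ... | z , z∈S , x~z with classify z∈S
  ...   | inj₁ refl          = contradiction x~z (irrefl G)
  ...   | inj₂ (inj₁ z≡c)    = z , x~z , inj₁ z≡c
  ...   | inj₂ (inj₂ z∈Out)  = z , x~z , inj₂ (proj₂ (∈Outside⇒ z∈Out))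

  few-neighbours-if-¬adjacent-to-centre : ∀ {x} → x ≢ c → ¬ Adj G x c →
    (N : Subset (suc r)) → (∀ {y} → y ∈ N → Adj G x y) → ¬ m < ∣ N ∣
  few-neighbours-if-¬adjacent-to-centre {x} x≢c ¬x~c N N⊆nbhd m<∣N∣ with ⊆-ofSize N m<∣N∣
  ... | q , q⊆N , ∣q∣≡1+m with ∣p∣>0⇒nonempty q (subst (0 <_) (sym ∣q∣≡1+m) (s≤s z≤n))
  ...   | y , y∈q = star-disconnected c∉S (x∈p∪q⁺ (inj₁ (x∈⁅x⁆ x))) (x∈p∪q⁺ (inj₂ y∈q)) x≢y
                      (Equivalence.to (same-connected S ∣S∣≡2+m) G-connected)
    where
    S : Subset (suc r)
    S = ⁅ x ⁆ ∪ q

    x∉q : x ∉ q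
    x∉q x∈q = irrefl G (N⊆nbhd (q⊆N x∈q))

    x≢y : x ≢ y
    x≢y refl = x∉q y∈q

    ∣S∣≡2+m : ∣ S ∣ ≡ 2 + m
    ∣S∣≡2+m = trans (x∉p⇒∣⁅x⁆∪p∣≡1+∣p∣ x∉q) (cong suc ∣q∣≡1+m)

    c∉S : c ∉ S
    c∉S c∈S with x∈p∪q⁻ ⁅ x ⁆ q c∈S
    ... | inj₁ c∈⁅x⁆ = x≢c (sym (x∈⁅y⁆⇒x≡y x c∈⁅x⁆))
    ... | inj₂ c∈q   = ¬x~c (N⊆nbhd (q⊆N c∈q))

    G-connected : Connected G S
    G-connected = dominated⇒connected (x∈p∪q⁺ (inj₁ (x∈⁅x⁆ x))) x-dominates
      where
      x-dominates : ∀ {z} → z ∈ S → z ≡ x ⊎ Adj G x z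
      x-dominates z∈S with x∈p∪q⁻ ⁅ x ⁆ q z∈S
      ... | inj₁ z∈⁅x⁆ = inj₁ (x∈⁅y⁆⇒x≡y x z∈⁅x⁆)
      ... | inj₂ z∈q   = inj₂ (N⊆nbhd (q⊆N z∈q))

  ¬¬adjacent-to-centre : ∀ {x} → x ≢ c → ¬ ¬ Adj G x c
  ¬¬adjacent-to-centre {x} x≢c ¬x~c = ¬¬-decidable (Adj G x) λ x~? →
    let N = subsetOf x~?
        ∣N∣≤m = ≮⇒≥ (few-neighbours-if-¬adjacent-to-centre x≢c ¬x~c N (∈-subsetOf⁻ x~?))
    in case neighbour-at-centre-or-outside x≢c N ∣N∣≤m of λ where
      (z , x~z , inj₁ z≡c)       → ¬x~c (subst (Adj G x) z≡c x~z)
      (z , x~z , inj₂ (_ , z∉N)) → z∉N (∈-subsetOf⁺ x~? x~z)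

  module _ (triangle-free : TriangleFree G) where

    leaves-nonadjacent : ∀ {x y} → x ≢ c → y ≢ c → ¬ Adj G x y
    leaves-nonadjacent {x} {y} x≢c y≢c x~y =
      ¬¬adjacent-to-centre x≢c λ x~c → ¬¬adjacent-to-centre y≢c λ y~c →
        triangle-free x y c (x~y , y~c , x~c)

    adjacent-to-centre : ∀ {x} → x ≢ c → Adj G x c
    adjacent-to-centre {x} x≢c
      with neighbour-at-centre-or-outside x≢c ⊥ (subst (_≤ m) (sym (∣⊥∣≡0 (suc r))) z≤n)
    ... | z , x~z , inj₁ z≡c       = subst (Adj G x) z≡c x~z
    ... | z , x~z , inj₂ (z≢c , _) = contradiction x~z (leaves-nonadjacent x≢c z≢c)

    adjacency-is-star : ∀ x y → Adj G x y ⇔ Adj (star c) x y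
    adjacency-is-star x y = mk⇔ to from
      where
      to : Adj G x y → StarAdj c x y
      to x~y with x ≟ c | y ≟ c
      ... | yes refl | yes refl = contradiction x~y (irrefl G)
      ... | yes x≡c  | no y≢c   = inj₁ (x≡c , y≢c)
      ... | no x≢c   | yes y≡c  = inj₂ (y≡c , x≢c)
      ... | no x≢c   | no y≢c   = contradiction x~y (leaves-nonadjacent x≢c y≢c)

      from : StarAdj c x y → Adj G x y
      from (inj₁ (refl , y≢c)) = Graph.sym G (adjacent-to-centre y≢c)
      from (inj₂ (refl , x≢c)) = adjacent-to-centre x≢c

lemma6 : (k r : ℕ) → 3 ≤ k → 3 * k ∸ 6 ≤ r → (c : Fin (suc r)) →
         (G : Graph (suc r)) → TriangleFree G →
         (∀ (S : Subset (suc r)) → ∣ S ∣ ≡ k →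
            (Connected G S ⇔ Connected (star c) S)
            × (Disconnected G S ⇔ Disconnected (star c) S)) →
         ∀ x y → Adj G x y ⇔ Adj (star c) x y
lemma6 (suc (suc (suc k))) r (s≤s (s≤s (s≤s _))) 3k∸6≤r c G triangle-free same-sets =
  StarReconstruction.adjacency-is-star (suc k) 2m<r c G
    (λ S ∣S∣≡k → proj₁ (same-sets S ∣S∣≡k)) triangle-free
  where
  3[2+m]≡6+3m : ∀ m → 3 * (2 + m) ≡ 6 + 3 * m
  3[2+m]≡6+3m = solve-∀

  2m<r : 2 * suc k < r
  2m<r = ≤-trans (*-monoˡ-< (suc k) {2} {3} ≤-refl)
           (subst (_≤ r) (trans (cong (_∸ 6) (3[2+m]≡6+3m (suc k))) (m+n∸m≡n 6 (3 * suc k))) 3k∸6≤r)
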